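{- For integers $n\ge 0$ and $k\ge 0$, let $t(n,k)$ denote the number of maximal independent sets of size exactly $k$ in the triangular cactus $T(n)$. Then, as formal power series in $x,y$, $$\sum_{n\ge 0}\sum_{k\ge 0} t(n,k)\,x^n y^k \;=\; \frac{1+2xy+x^2y^2}{1-xy-x^2y}.$$
   Context: For $n\ge 1$, the triangular cactus $T(n)$ is the graph formed by a chain of $n$ triangles (copies of $C_3$) $B_1,\dots,B_n$, where for each $1\le i\le n-1$ the consecutive triangles $B_i$ and $B_{i+1}$ share exactly one vertex, non-consecutive triangles share no vertex, and every vertex lies in at most two triangles (so $T(n)$ has $2n+1$ vertices and its block–cut-vertex tree is a path). $T(0)$ is the empty graph, whose only maximal independent set is the empty set, so $t(0,0)=1$ and $t(0,k)=0$ for $k\ge 1$. An independent set is maximal if no further vertex can be added while keeping it independent. -}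

module Defs where

open import Data.Nat as ℕ using (ℕ; zero; suc; _+_; _*_; _∸_; _%_)
open import Data.Nat.Properties using () renaming (_≟_ to _≟ℕ_)
open import Data.Integer as ℤ using (ℤ)
open import Data.Fin using (Fin; toℕ)
open import Data.Fin.Properties using (all?)
open import Data.Fin.Subset using (Subset; inside; outside; _∈_; _∉_; _∪_; ⁅_⁆; ∣_∣)
open import Data.Fin.Subset.Properties using (_∈?_)
open import Data.Vec using ([]; _∷_)
open import Data.List using (List; []; _∷_; map; _++_; filter; length)
open import Data.Product using (_×_; _,_)
open import Data.Sum using (_⊎_)
open import Relation.Nullary using (¬_; Dec; yes; no)
open import Relation.Nullary.Decidable using (_×-dec_; _⊎-dec_; _→-dec_; ¬?)
open import Relation.Binary.PropositionalEquality using (_≡_)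

-- For n ≥ 1, T(n) has 2n+1 vertices 0,…,2n and
-- triangle B_i (i = 0,…,n-1) has vertex set {2i, 2i+1, 2i+2};
-- consecutive triangles B_i, B_{i+1} share exactly the vertex 2i+2.

numVertices : ℕ → ℕ
numVertices zero    = 0
numVertices (suc n) = suc (2 * suc n)

Edge : ℕ → ℕ → Set
Edge u v = (v ≡ suc u) ⊎ ((v ≡ suc (suc u)) × (u % 2 ≡ 0))

Adj : ℕ → ℕ → Set
Adj u v = Edge u v ⊎ Edge v u

edge? : (u v : ℕ) → Dec (Edge u v)
edge? u v = (v ≟ℕ suc u) ⊎-dec ((v ≟ℕ suc (suc u)) ×-dec (u % 2 ≟ℕ 0))

adj? : (u v : ℕ) → Dec (Adj u v)
adj? u v = edge? u v ⊎-dec edge? v u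

Independent : (n : ℕ) → Subset (numVertices n) → Set
Independent n S = ∀ (u v : Fin (numVertices n)) → u ∈ S → v ∈ S → ¬ Adj (toℕ u) (toℕ v)

MaximalIndependent : (n : ℕ) → Subset (numVertices n) → Set
MaximalIndependent n S =
  Independent n S × (∀ (v : Fin (numVertices n)) → v ∉ S → ¬ Independent n (S ∪ ⁅ v ⁆))

independent? : (n : ℕ) → (S : Subset (numVertices n)) → Dec (Independent n S)
independent? n S = all? λ u → all? λ v →
  (u ∈? S) →-dec ((v ∈? S) →-dec ¬? (adj? (toℕ u) (toℕ v)))

maximalIndependent? : (n : ℕ) → (S : Subset (numVertices n)) → Dec (MaximalIndependent n S)
maximalIndependent? n S = independent? n S ×-dec
  all? (λ v → ¬? (v ∈? S) →-dec ¬? (independent? n (S ∪ ⁅ v ⁆)))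

allSubsets : (m : ℕ) → List (Subset m)
allSubsets zero    = [] ∷ []
allSubsets (suc m) = map (inside ∷_) (allSubsets m) ++ map (outside ∷_) (allSubsets m)

t : ℕ → ℕ → ℕ
t n k = length (filter (λ S → maximalIndependent? n S ×-dec (∣ S ∣ ≟ℕ k))
                       (allSubsets (numVertices n)))

-- Formal power series in x, y with integer coefficients:
-- F n k is the coefficient of x^n y^k.

FPS : Set
FPS = ℕ → ℕ → ℤ

sumTo : ℕ → (ℕ → ℤ) → ℤ
sumTo zero    f = f 0
sumTo (suc n) f = sumTo n f ℤ.+ f (suc n)

_⋆_ : FPS → FPS → FPS
(F ⋆ G) n k = sumTo n λ i → sumTo k λ j → F i j ℤ.* G (n ∸ i) (k ∸ j)

mono : ℤ → ℕ → ℕ → FPS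
mono c a b n k with n ≟ℕ a | k ≟ℕ b
... | yes _ | yes _ = c
... | _         | _         = ℤ.0ℤ

_⊕_ : FPS → FPS → FPS
(F ⊕ G) n k = F n k ℤ.+ G n k

tGF : FPS
tGF n k = ℤ.+ t n k

numer : FPS
numer = mono (ℤ.+ 1) 0 0 ⊕ (mono (ℤ.+ 2) 1 1 ⊕ mono (ℤ.+ 1) 2 2)

denom : FPS
denom = mono (ℤ.+ 1) 0 0 ⊕ (mono (ℤ.- (ℤ.+ 1)) 1 1 ⊕ mono (ℤ.- (ℤ.+ 1)) 2 1)

{-# OPTIONS --safe #-}
module Submission where

-- An independent set of T(n) has at most one vertex in each triangle, and it is maximal
-- exactly when it has one in every triangle: a triangle without a chosen vertex leaves its
-- middle vertex (which lies in no other triangle) undominated.  So t(n,k) counts the ways to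
-- choose one vertex per triangle, k distinct vertices in all.  Splitting according to whether
-- the first vertex is chosen gives t(n+3,k+1) = t(n+2,k) + t(n+1,k) and t(n+1,0) = 0, so
-- multiplying by 1 - xy - x²y leaves only the coefficients coming from t(0,·), t(1,·), t(2,·).

open import Defs
open import Relation.Binary.PropositionalEquality using (_≡_; refl; cong; trans; module ≡-Reasoning)

module PowerSeries where

  open import Data.Empty using (⊥-elim)
  open import Data.Integer as ℤ using (ℤ; 0ℤ; 1ℤ; -1ℤ; _+_; _*_; _-_)
  import Data.Integer.Properties as ℤ
  open import Data.Integer.Solver using (module +-*-Solver)
  open import Data.Nat using (ℕ; zero; suc; _∸_; _≤_; _<_; z≤n; s≤s)
  open import Data.Nat.Properties
    using (_≟_; _≤?_; ≤-refl; ≤-pred; m≤n⇒m≤1+n; m∸n≤m; m∸[m∸n]≡n; <⇒≢; ≰⇒>; ≤-<-trans; ≤∧≢⇒<)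
  open import Data.Sum using (_⊎_; inj₁; inj₂; [_,_])
  open import Function using (_∘_)
  open import Relation.Binary.PropositionalEquality hiding ([_])
  open import Relation.Nullary using (yes; no)

  sumTo-cong : ∀ n {f g : ℕ → ℤ} → (∀ i → f i ≡ g i) → sumTo n f ≡ sumTo n g
  sumTo-cong zero    f≗g = f≗g 0
  sumTo-cong (suc n) f≗g = cong₂ _+_ (sumTo-cong n f≗g) (f≗g (suc n))

  sumTo-+ : ∀ n (f g : ℕ → ℤ) → sumTo n (λ i → f i + g i) ≡ sumTo n f + sumTo n g
  sumTo-+ zero    f g = refl
  sumTo-+ (suc n) f g = begin
    sumTo n (λ i → f i + g i) + (f (suc n) + g (suc n))
      ≡⟨ cong (_+ (f (suc n) + g (suc n))) (sumTo-+ n f g) ⟩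
    (sumTo n f + sumTo n g) + (f (suc n) + g (suc n))
      ≡⟨ solve 4 (λ a b c d → (a :+ b) :+ (c :+ d) := (a :+ c) :+ (b :+ d)) refl
           (sumTo n f) (sumTo n g) (f (suc n)) (g (suc n)) ⟩
    (sumTo n f + f (suc n)) + (sumTo n g + g (suc n)) ∎
    where
      open ≡-Reasoning
      open +-*-Solver

  sumTo-zero : ∀ n {f : ℕ → ℤ} → (∀ i → i ≤ n → f i ≡ 0ℤ) → sumTo n f ≡ 0ℤ
  sumTo-zero zero    f≡0 = f≡0 0 z≤n
  sumTo-zero (suc n) f≡0 =
    cong₂ _+_ (sumTo-zero n (λ i i≤n → f≡0 i (m≤n⇒m≤1+n i≤n))) (f≡0 (suc n) ≤-refl)

  sumTo-single : ∀ {n m} {f : ℕ → ℤ} → m ≤ n → (∀ i → i ≤ n → i ≢ m → f i ≡ 0ℤ) →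
                 sumTo n f ≡ f m
  sumTo-single {zero} z≤n _ = refl
  sumTo-single {suc n} {m} {f} m≤1+n f≡0 with m ≟ suc n
  ... | yes refl = trans
    (cong (_+ f m) (sumTo-zero n λ i i≤n → f≡0 i (m≤n⇒m≤1+n i≤n) (<⇒≢ (s≤s i≤n))))
    (ℤ.+-identityˡ (f m))
  ... | no m≢1+n = trans
    (cong₂ _+_ (sumTo-single (≤-pred (≤∧≢⇒< m≤1+n m≢1+n)) λ i i≤n → f≡0 i (m≤n⇒m≤1+n i≤n))
               (f≡0 (suc n) ≤-refl (m≢1+n ∘ sym)))
    (ℤ.+-identityʳ (f m))

  ⋆-distribˡ-⊕ : ∀ F G H n k → (F ⋆ (G ⊕ H)) n k ≡ (F ⋆ G) n k + (F ⋆ H) n k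
  ⋆-distribˡ-⊕ F G H n k = trans
    (sumTo-cong n λ i → trans
      (sumTo-cong k λ j → ℤ.*-distribˡ-+ (F i j) (G (n ∸ i) (k ∸ j)) (H (n ∸ i) (k ∸ j)))
      (sumTo-+ k _ _))
    (sumTo-+ n _ _)

  mono-diag : ∀ c a b → mono c a b a b ≡ c
  mono-diag c a b with a ≟ a | b ≟ b
  ... | yes _  | yes _  = refl
  ... | no a≢a | _      = ⊥-elim (a≢a refl)
  ... | yes _  | no b≢b = ⊥-elim (b≢b refl)

  mono-off : ∀ c {a b p q} → p ≢ a ⊎ q ≢ b → mono c a b p q ≡ 0ℤ
  mono-off c {a} {b} {p} {q} off with p ≟ a | q ≟ b
  ... | yes p≡a | yes q≡b = ⊥-elim ([ (λ p≢a → p≢a p≡a) , (λ q≢b → q≢b q≡b) ] off)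
  ... | no _    | _       = refl
  ... | yes _   | no _    = refl

  *-mono-off : ∀ x c {a b p q} → p ≢ a ⊎ q ≢ b → x * mono c a b p q ≡ 0ℤ
  *-mono-off x c off = trans (cong (x *_) (mono-off c off)) (ℤ.*-zeroʳ x)

  shift : ℕ → ℕ → FPS → FPS
  shift a b F n k with a ≤? n | b ≤? k
  ... | yes _ | yes _ = F (n ∸ a) (k ∸ b)
  ... | _     | _     = 0ℤ

  m∸n≡o⇒n≡m∸o : ∀ {m n o} → n ≤ m → m ∸ n ≡ o → n ≡ m ∸ o
  m∸n≡o⇒n≡m∸o n≤m refl = sym (m∸[m∸n]≡n n≤m)

  m<o⇒m∸n≢o : ∀ {m o} n → m < o → m ∸ n ≢ o
  m<o⇒m∸n≢o {m} n m<o = <⇒≢ (≤-<-trans (m∸n≤m m n) m<o)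

  ⋆-mono : ∀ F c a b n k → (F ⋆ mono c a b) n k ≡ shift a b F n k * c
  ⋆-mono F c a b n k with a ≤? n | b ≤? k
  ... | yes a≤n | yes b≤k = begin
    sumTo n (λ i → sumTo k λ j → F i j * mono c a b (n ∸ i) (k ∸ j))
      ≡⟨ sumTo-single (m∸n≤m n a) (λ i i≤n i≢n∸a → sumTo-zero k λ j _ →
           *-mono-off (F i j) c (inj₁ (i≢n∸a ∘ m∸n≡o⇒n≡m∸o i≤n))) ⟩
    sumTo k (λ j → F (n ∸ a) j * mono c a b (n ∸ (n ∸ a)) (k ∸ j))
      ≡⟨ sumTo-single (m∸n≤m k b) (λ j j≤k j≢k∸b →
           *-mono-off (F (n ∸ a) j) c (inj₂ (j≢k∸b ∘ m∸n≡o⇒n≡m∸o j≤k))) ⟩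
    F (n ∸ a) (k ∸ b) * mono c a b (n ∸ (n ∸ a)) (k ∸ (k ∸ b))
      ≡⟨ cong (F (n ∸ a) (k ∸ b) *_) (trans
           (cong₂ (mono c a b) (m∸[m∸n]≡n a≤n) (m∸[m∸n]≡n b≤k)) (mono-diag c a b)) ⟩
    F (n ∸ a) (k ∸ b) * c ∎
    where
      open ≡-Reasoning
  ... | no a≰n | _ = sumTo-zero n λ i _ → sumTo-zero k λ j _ →
    *-mono-off (F i j) c (inj₁ (m<o⇒m∸n≢o i (≰⇒> a≰n)))
  ... | yes _ | no b≰k = sumTo-zero n λ i _ → sumTo-zero k λ j _ →
    *-mono-off (F i j) c (inj₂ (m<o⇒m∸n≢o j (≰⇒> b≰k)))

  ⋆-denom : ∀ F n k → (F ⋆ denom) n k ≡ F n k - (shift 1 1 F n k + shift 2 1 F n k)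
  ⋆-denom F n k = begin
    (F ⋆ denom) n k
      ≡⟨ ⋆-distribˡ-⊕ F (mono 1ℤ 0 0) (mono -1ℤ 1 1 ⊕ mono -1ℤ 2 1) n k ⟩
    (F ⋆ mono 1ℤ 0 0) n k + (F ⋆ (mono -1ℤ 1 1 ⊕ mono -1ℤ 2 1)) n k
      ≡⟨ cong ((F ⋆ mono 1ℤ 0 0) n k +_) (⋆-distribˡ-⊕ F (mono -1ℤ 1 1) (mono -1ℤ 2 1) n k) ⟩
    (F ⋆ mono 1ℤ 0 0) n k + ((F ⋆ mono -1ℤ 1 1) n k + (F ⋆ mono -1ℤ 2 1) n k)
      ≡⟨ cong₂ _+_ (⋆-mono F 1ℤ 0 0 n k)
           (cong₂ _+_ (⋆-mono F -1ℤ 1 1 n k) (⋆-mono F -1ℤ 2 1 n k)) ⟩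
    F n k * 1ℤ + (shift 1 1 F n k * -1ℤ + shift 2 1 F n k * -1ℤ)
      ≡⟨ solve 3 (λ f s₁ s₂ → f :* con 1ℤ :+ (s₁ :* con -1ℤ :+ s₂ :* con -1ℤ) := f :- (s₁ :+ s₂))
           refl (F n k) (shift 1 1 F n k) (shift 2 1 F n k) ⟩
    F n k - (shift 1 1 F n k + shift 2 1 F n k) ∎
    where
      open ≡-Reasoning
      open +-*-Solver

module Counting where

  open import Data.Bool using (Bool; true; false; if_then_else_)
  open import Data.Fin.Subset using (Subset; inside; outside; ∣_∣)
  open import Data.List using (List; []; _∷_; map; _++_; filter; length)
  open import Data.List.Properties using (filter-++; length-++)
  open import Data.Nat using (ℕ; zero; suc; _+_)
  open import Data.Vec using ([]; _∷_; toList)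
  open import Function using (_∘_)
  open import Relation.Binary.PropositionalEquality
  open import Relation.Nullary using (does)
  open import Relation.Unary using (Pred; Decidable)

  ones : List Bool → ℕ
  ones []          = 0
  ones (true ∷ l)  = suc (ones l)
  ones (false ∷ l) = ones l

  ∣∣≡ones : ∀ {m} (S : Subset m) → ∣ S ∣ ≡ ones (toList S)
  ∣∣≡ones []          = refl
  ∣∣≡ones (true ∷ S)  = cong suc (∣∣≡ones S)
  ∣∣≡ones (false ∷ S) = ∣∣≡ones S

  countLists : ℕ → (List Bool → Bool) → ℕ
  countLists zero    P = if P [] then 1 else 0
  countLists (suc m) P = countLists m (P ∘ (true ∷_)) + countLists m (P ∘ (false ∷_))

  countLists-cong : ∀ m {P Q : List Bool → Bool} → (∀ l → P l ≡ Q l) →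
                    countLists m P ≡ countLists m Q
  countLists-cong zero    P≗Q = cong (if_then 1 else 0) (P≗Q [])
  countLists-cong (suc m) P≗Q =
    cong₂ _+_ (countLists-cong m (P≗Q ∘ (true ∷_))) (countLists-cong m (P≗Q ∘ (false ∷_)))

  countLists-false : ∀ m → countLists m (λ _ → false) ≡ 0
  countLists-false zero    = refl
  countLists-false (suc m) = cong₂ _+_ (countLists-false m) (countLists-false m)

  module _ {a p} {A : Set a} {P : Pred A p} (P? : Decidable P) where

    length-filter-[_] : ∀ x → length (filter P? (x ∷ [])) ≡ (if does (P? x) then 1 else 0)
    length-filter-[ x ] with does (P? x)
    ... | true  = refl
    ... | false = refl

    length-filter-++ : ∀ xs ys →
                       length (filter P? (xs ++ ys)) ≡ length (filter P? xs) + length (filter P? ys)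
    length-filter-++ xs ys = trans (cong length (filter-++ P? xs ys)) (length-++ (filter P? xs))

  length-filter-map : ∀ {a b p} {A : Set a} {B : Set b} {P : Pred B p} (P? : Decidable P)
                      (f : A → B) xs → length (filter P? (map f xs)) ≡ length (filter (P? ∘ f) xs)
  length-filter-map P? f []       = refl
  length-filter-map P? f (x ∷ xs) with does (P? (f x))
  ... | true  = cong suc (length-filter-map P? f xs)
  ... | false = length-filter-map P? f xs

  length-filter-allSubsets : ∀ m {p} {P : Pred (Subset m) p} (P? : Decidable P)
    (Q : List Bool → Bool) → (∀ S → does (P? S) ≡ Q (toList S)) →
    length (filter P? (allSubsets m)) ≡ countLists m Q
  length-filter-allSubsets zero P? Q P?≡Q =
    trans (length-filter-[ P? ] []) (cong (if_then 1 else 0) (P?≡Q []))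
  length-filter-allSubsets (suc m) P? Q P?≡Q = begin
    length (filter P? (map (inside ∷_) (allSubsets m) ++ map (outside ∷_) (allSubsets m)))
      ≡⟨ length-filter-++ P? (map (inside ∷_) (allSubsets m)) (map (outside ∷_) (allSubsets m)) ⟩
    length (filter P? (map (inside ∷_) (allSubsets m)))
      + length (filter P? (map (outside ∷_) (allSubsets m)))
      ≡⟨ cong₂ _+_ (length-filter-map P? (inside ∷_) (allSubsets m))
                   (length-filter-map P? (outside ∷_) (allSubsets m)) ⟩
    length (filter (P? ∘ (inside ∷_)) (allSubsets m))
      + length (filter (P? ∘ (outside ∷_)) (allSubsets m))
      ≡⟨ cong₂ _+_ (length-filter-allSubsets m (P? ∘ (inside ∷_)) (Q ∘ (true ∷_)) (P?≡Q ∘ (inside ∷_)))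
                   (length-filter-allSubsets m (P? ∘ (outside ∷_)) (Q ∘ (false ∷_)) (P?≡Q ∘ (outside ∷_))) ⟩
    countLists (suc m) Q ∎
    where
      open ≡-Reasoning

module TriangularCactus where

  open Counting
  open import Data.Bool using (Bool; true; false; _∧_)
  open import Data.Bool.Properties using (∧-conicalˡ; ∧-conicalʳ; ∧-zeroʳ)
  open import Data.Empty using (⊥; ⊥-elim)
  open import Data.Fin using (Fin; zero; suc; toℕ; fromℕ<)
  open import Data.Fin.Properties using (toℕ<n; toℕ-fromℕ<; toℕ-injective)
  open import Data.Fin.Subset using (Subset; _∈_; _∉_; _∪_; ⁅_⁆)
  open import Data.Fin.Subset.Properties using (x∈p∪q⁺; x∈p∪q⁻; x∈⁅x⁆; x∈⁅y⁆⇒x≡y)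
  open import Data.List using (List; []; _∷_; drop)
  open import Data.Nat using (ℕ; zero; suc; _+_; _*_; _%_; _≤_; _<_; _≡ᵇ_; z≤n; s≤s)
  open import Data.Nat.Properties
    using (suc-injective; ≤-pred; n≤1+n; ≤-trans; +-suc; +-identityʳ; m≢1+n+m)
  open import Data.Nat.Solver using (module +-*-Solver)
  open import Data.Product using (_×_; _,_; ∃)
  open import Data.Sum using (_⊎_; inj₁; inj₂; [_,_])
  open import Data.Vec using (_∷_; toList; here; there)
  open import Relation.Binary.PropositionalEquality hiding ([_])
  open import Relation.Nullary using (¬_; does)
  open import Relation.Nullary.Decidable using (dec-true; dec-false)

  double : ℕ → ℕ
  double zero    = zero
  double (suc n) = suc (suc (double n))

  double≡2* : ∀ n → double n ≡ 2 * n
  double≡2* zero    = refl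
  double≡2* (suc n) = cong suc (trans (cong suc (double≡2* n)) (sym (+-suc n (n + 0))))

  double-mono-≤ : ∀ {i n} → i ≤ n → double i ≤ double n
  double-mono-≤ z≤n       = z≤n
  double-mono-≤ (s≤s i≤n) = s≤s (s≤s (double-mono-≤ i≤n))

  double-cancel-≤ : ∀ i n → double i ≤ double n → i ≤ n
  double-cancel-≤ zero    n       _                 = z≤n
  double-cancel-≤ (suc i) (suc n) (s≤s (s≤s 2i≤2n)) = s≤s (double-cancel-≤ i n 2i≤2n)

  double-cancel-< : ∀ i n → double i < double n → i < n
  double-cancel-< zero    (suc n) _                 = s≤s z≤n
  double-cancel-< (suc i) (suc n) (s≤s (s≤s 2i<2n)) = s≤s (double-cancel-< i n 2i<2n)

  double%2≡0 : ∀ i → double i % 2 ≡ 0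
  double%2≡0 zero    = refl
  double%2≡0 (suc i) = double%2≡0 i

  1+double%2≡1 : ∀ i → suc (double i) % 2 ≡ 1
  1+double%2≡1 zero    = refl
  1+double%2≡1 (suc i) = 1+double%2≡1 i

  double≢1+double : ∀ i j → double i ≢ suc (double j)
  double≢1+double zero    j       ()
  double≢1+double (suc i) zero    ()
  double≢1+double (suc i) (suc j) e = double≢1+double i j (suc-injective (suc-injective e))

  data Parity : ℕ → Set where
    even : ∀ i → Parity (double i)
    odd  : ∀ i → Parity (suc (double i))

  parity : ∀ x → Parity x
  parity zero = even 0
  parity (suc x) with parity x
  ... | even i = odd i
  ... | odd i  = even (suc i)

  Adj-sym : ∀ {x y} → Adj x y → Adj y x
  Adj-sym (inj₁ e) = inj₂ e
  Adj-sym (inj₂ e) = inj₁ e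

  Edge-irrefl : ∀ {x} → ¬ Edge x x
  Edge-irrefl {x} (inj₁ x≡1+x)       = m≢1+n+m x {0} x≡1+x
  Edge-irrefl {x} (inj₂ (x≡2+x , _)) = m≢1+n+m x {1} x≡2+x

  Adj-irrefl : ∀ {x} → ¬ Adj x x
  Adj-irrefl (inj₁ e) = Edge-irrefl e
  Adj-irrefl (inj₂ e) = Edge-irrefl e

  Adj-odd : ∀ {i x} → Adj x (suc (double i)) → x ≡ double i ⊎ x ≡ suc (suc (double i))
  Adj-odd (inj₁ (inj₁ e)) = inj₁ (sym (suc-injective e))
  Adj-odd {i} {x} (inj₁ (inj₂ (e , x%2≡0))) with parity x
  ... | even j = ⊥-elim (double≢1+double i j (suc-injective e))
  ... | odd j  with () ← trans (sym (1+double%2≡1 j)) x%2≡0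
  Adj-odd (inj₂ (inj₁ e)) = inj₂ e
  Adj-odd {i} (inj₂ (inj₂ (_ , 1+2i%2≡0))) with () ← trans (sym (1+double%2≡1 i)) 1+2i%2≡0

  bit : List Bool → ℕ → Bool
  bit []      _       = false
  bit (b ∷ _) zero    = b
  bit (_ ∷ l) (suc x) = bit l x

  exactlyOne : Bool → Bool → Bool → Bool
  exactlyOne true  false false = true
  exactlyOne false true  false = true
  exactlyOne false false true  = true
  exactlyOne _     _     _     = false

  exactlyOneIn : List Bool → ℕ → Bool
  exactlyOneIn l i =
    exactlyOne (bit l (double i)) (bit l (suc (double i))) (bit l (suc (suc (double i))))

  OnePerTriangle : ℕ → List Bool → Set
  OnePerTriangle n l = ∀ i → i < n → exactlyOneIn l i ≡ true

  Dominated : List Bool → ℕ → Set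
  Dominated l y = ∃ λ x → bit l x ≡ true × Adj x y

  true≢false : ∀ {b} → b ≡ true → b ≢ false
  true≢false refl ()

  exactlyOne-¬₁₂ : ∀ {a b c} → exactlyOne a b c ≡ true → a ≡ true → b ≡ true → ⊥
  exactlyOne-¬₁₂ {c = true}  () refl refl
  exactlyOne-¬₁₂ {c = false} () refl refl

  exactlyOne-¬₂₃ : ∀ {a b c} → exactlyOne a b c ≡ true → b ≡ true → c ≡ true → ⊥
  exactlyOne-¬₂₃ {a = true}  () refl refl
  exactlyOne-¬₂₃ {a = false} () refl refl

  exactlyOne-¬₁₃ : ∀ {a b c} → exactlyOne a b c ≡ true → a ≡ true → c ≡ true → ⊥
  exactlyOne-¬₁₃ {b = true}  () refl refl
  exactlyOne-¬₁₃ {b = false} () refl refl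

  exactlyOne-some : ∀ {a b c} → exactlyOne a b c ≡ true → a ≡ true ⊎ b ≡ true ⊎ c ≡ true
  exactlyOne-some {true}                 _ = inj₁ refl
  exactlyOne-some {false} {true}         _ = inj₂ (inj₁ refl)
  exactlyOne-some {false} {false} {true} _ = inj₂ (inj₂ refl)

  data ExactlyOneView (a b c : Bool) : Set where
    exactly-one  : exactlyOne a b c ≡ true → ExactlyOneView a b c
    first-second : a ≡ true → b ≡ true → ExactlyOneView a b c
    second-third : b ≡ true → c ≡ true → ExactlyOneView a b c
    first-third  : a ≡ true → c ≡ true → ExactlyOneView a b c
    none         : a ≡ false → b ≡ false → c ≡ false → ExactlyOneView a b c

  exactlyOne-view : ∀ a b c → ExactlyOneView a b c
  exactlyOne-view true  true  _     = first-second refl refl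
  exactlyOne-view true  false true  = first-third refl refl
  exactlyOne-view true  false false = exactly-one refl
  exactlyOne-view false true  true  = second-third refl refl
  exactlyOne-view false true  false = exactly-one refl
  exactlyOne-view false false true  = exactly-one refl
  exactlyOne-view false false false = none refl refl refl

  onePerTriangle⇒¬Edge : ∀ {n l x y} → OnePerTriangle n l → y ≤ double n →
                          bit l x ≡ true → bit l y ≡ true → ¬ Edge x y
  onePerTriangle⇒¬Edge {n} {x = x} one y≤2n bx by (inj₁ refl) with parity x
  ... | even i = exactlyOne-¬₁₂ (one i (double-cancel-< i n y≤2n)) bx by
  ... | odd i  = exactlyOne-¬₂₃ (one i (double-cancel-< i n (≤-trans (n≤1+n _) y≤2n))) bx by
  onePerTriangle⇒¬Edge {n} {x = x} one y≤2n bx by (inj₂ (refl , x%2≡0)) with parity x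
  ... | even i = exactlyOne-¬₁₃ (one i (double-cancel-< i n (≤-trans (n≤1+n _) y≤2n))) bx by
  ... | odd i  with () ← trans (sym (1+double%2≡1 i)) x%2≡0

  -- An even vertex 2j+2 is dominated inside triangle j, vertex 0 inside triangle 0.
  onePerTriangle⇒dominated : ∀ {n l y} → OnePerTriangle (suc n) l → y ≤ double (suc n) →
                             bit l y ≡ false → Dominated l y
  onePerTriangle⇒dominated {n} {l} {y} one y≤2n+2 by with parity y
  ... | odd i with exactlyOne-some (one i (double-cancel-< i (suc n) y≤2n+2))
  ...   | inj₁ a        = double i , a , inj₁ (inj₁ refl)
  ...   | inj₂ (inj₁ b) = ⊥-elim (true≢false b by)
  ...   | inj₂ (inj₂ c) = suc (suc (double i)) , c , inj₂ (inj₁ refl)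
  onePerTriangle⇒dominated one _ by | even zero with exactlyOne-some (one 0 (s≤s z≤n))
  ...   | inj₁ a        = ⊥-elim (true≢false a by)
  ...   | inj₂ (inj₁ b) = 1 , b , inj₂ (inj₁ refl)
  ...   | inj₂ (inj₂ c) = 2 , c , inj₂ (inj₂ (refl , refl))
  onePerTriangle⇒dominated {n} one (s≤s (s≤s 2j≤2n)) by | even (suc j)
    with exactlyOne-some (one j (s≤s (double-cancel-≤ j n 2j≤2n)))
  ...   | inj₁ a        = double j , a , inj₁ (inj₂ (refl , double%2≡0 j))
  ...   | inj₂ (inj₁ b) = suc (double j) , b , inj₁ (inj₁ refl)
  ...   | inj₂ (inj₂ c) = ⊥-elim (true≢false c by)

  independent∧maximal⇒onePerTriangle : ∀ {n l} →
    (∀ x y → bit l x ≡ true → bit l y ≡ true → ¬ Adj x y) →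
    (∀ y → y ≤ double n → bit l y ≡ false → ¬ ¬ Dominated l y) →
    OnePerTriangle n l
  independent∧maximal⇒onePerTriangle {l = l} independent maximal i i<n
    with exactlyOne-view (bit l (double i)) (bit l (suc (double i))) (bit l (suc (suc (double i))))
  ... | exactly-one e    = e
  ... | first-second a b = ⊥-elim (independent _ _ a b (inj₁ (inj₁ refl)))
  ... | second-third b c = ⊥-elim (independent _ _ b c (inj₁ (inj₁ refl)))
  ... | first-third a c  = ⊥-elim (independent _ _ a c (inj₁ (inj₂ (refl , double%2≡0 i))))
  ... | none a b c       = ⊥-elim (maximal (suc (double i)) (≤-trans (n≤1+n _) (double-mono-≤ i<n)) b
    λ (x , bx , x~m) → [ (λ { refl → true≢false bx a }) , (λ { refl → true≢false bx c }) ] (Adj-odd x~m))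

  onePerTriangleᵇ : ℕ → List Bool → Bool
  onePerTriangleᵇ zero    _ = true
  onePerTriangleᵇ (suc n) l = exactlyOneIn l 0 ∧ onePerTriangleᵇ n (drop 2 l)

  exactlyOneIn-drop : ∀ l i → exactlyOneIn (drop 2 l) i ≡ exactlyOneIn l (suc i)
  exactlyOneIn-drop []          i = refl
  exactlyOneIn-drop (_ ∷ [])    i = refl
  exactlyOneIn-drop (_ ∷ _ ∷ l) i = refl

  onePerTriangleᵇ-sound : ∀ n l → onePerTriangleᵇ n l ≡ true → OnePerTriangle n l
  onePerTriangleᵇ-sound (suc n) l e zero    _         = ∧-conicalˡ _ _ e
  onePerTriangleᵇ-sound (suc n) l e (suc i) (s≤s i<n) = trans (sym (exactlyOneIn-drop l i))
    (onePerTriangleᵇ-sound n (drop 2 l) (∧-conicalʳ _ _ e) i i<n)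

  onePerTriangleᵇ-complete : ∀ n l → OnePerTriangle n l → onePerTriangleᵇ n l ≡ true
  onePerTriangleᵇ-complete zero    l _   = refl
  onePerTriangleᵇ-complete (suc n) l one = cong₂ _∧_ (one 0 (s≤s z≤n))
    (onePerTriangleᵇ-complete n (drop 2 l) λ i i<n →
      trans (exactlyOneIn-drop l i) (one (suc i) (s≤s i<n)))

  ∈⇒bit : ∀ {m} {S : Subset m} {u} → u ∈ S → bit (toList S) (toℕ u) ≡ true
  ∈⇒bit here        = refl
  ∈⇒bit (there u∈S) = ∈⇒bit u∈S

  bit⇒∈ : ∀ {m} (S : Subset m) {x} → bit (toList S) x ≡ true → ∃ λ u → toℕ u ≡ x × u ∈ S
  bit⇒∈ (true ∷ S) {zero}  refl = zero , refl , here
  bit⇒∈ (_ ∷ S)    {suc x} bx   with bit⇒∈ S bx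
  ... | u , refl , u∈S = suc u , refl , there u∈S

  ∉⇒bit : ∀ {m} (S : Subset m) {u} → u ∉ S → bit (toList S) (toℕ u) ≡ false
  ∉⇒bit S {u} u∉S with bit (toList S) (toℕ u) in bu
  ... | false = refl
  ... | true with bit⇒∈ S bu
  ...   | u′ , eq , u′∈S = ⊥-elim (u∉S (subst (_∈ S) (toℕ-injective eq) u′∈S))

  numVertices-suc : ∀ n → numVertices (suc n) ≡ suc (double (suc n))
  numVertices-suc n = cong suc (sym (double≡2* (suc n)))

  toℕ≤double : ∀ {n} (u : Fin (numVertices (suc n))) → toℕ u ≤ double (suc n)
  toℕ≤double {n} u = ≤-pred (subst (toℕ u <_) (numVertices-suc n) (toℕ<n u))

  onePerTriangle⇒maximalIndependent : ∀ n S → OnePerTriangle (suc n) (toList S) →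
                                      MaximalIndependent (suc n) S
  onePerTriangle⇒maximalIndependent n S one = independent , maximal
    where
      independent : Independent (suc n) S
      independent u w u∈S w∈S (inj₁ u→w) =
        onePerTriangle⇒¬Edge {l = toList S} one (toℕ≤double w) (∈⇒bit u∈S) (∈⇒bit w∈S) u→w
      independent u w u∈S w∈S (inj₂ w→u) =
        onePerTriangle⇒¬Edge {l = toList S} one (toℕ≤double u) (∈⇒bit w∈S) (∈⇒bit u∈S) w→u

      maximal : ∀ v → v ∉ S → ¬ Independent (suc n) (S ∪ ⁅ v ⁆)
      maximal v v∉S independent′
        with onePerTriangle⇒dominated {l = toList S} one (toℕ≤double v) (∉⇒bit S v∉S)
      ... | x , bx , x~v with bit⇒∈ S {x} bx
      ...   | u , refl , u∈S =
        independent′ u v (x∈p∪q⁺ (inj₁ u∈S)) (x∈p∪q⁺ (inj₂ (x∈⁅x⁆ v))) x~v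

  maximalIndependent⇒onePerTriangle : ∀ n S → MaximalIndependent (suc n) S →
                                      OnePerTriangle (suc n) (toList S)
  maximalIndependent⇒onePerTriangle n S (independent , maximal) =
    independent∧maximal⇒onePerTriangle {l = toList S} independentᵇ maximalᵇ
    where
      independentᵇ : ∀ x y → bit (toList S) x ≡ true → bit (toList S) y ≡ true → ¬ Adj x y
      independentᵇ x y bx by x~y with bit⇒∈ S {x} bx | bit⇒∈ S {y} by
      ... | u , refl , u∈S | w , refl , w∈S = independent u w u∈S w∈S x~y

      maximalᵇ : ∀ y → y ≤ double (suc n) → bit (toList S) y ≡ false → ¬ ¬ Dominated (toList S) y
      maximalᵇ y y≤2n+2 by undominated = maximal v v∉S independent′
        where
          y<|V| : y < numVertices (suc n)
          y<|V| = subst (y <_) (sym (numVertices-suc n)) (s≤s y≤2n+2)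

          v : Fin (numVertices (suc n))
          v = fromℕ< y<|V|

          toℕv≡y : toℕ v ≡ y
          toℕv≡y = toℕ-fromℕ< y<|V|

          v∉S : v ∉ S
          v∉S v∈S = true≢false (trans (sym (cong (bit (toList S)) toℕv≡y)) (∈⇒bit v∈S)) by

          independent′ : Independent (suc n) (S ∪ ⁅ v ⁆)
          independent′ u w u∈S∪v w∈S∪v u~w with x∈p∪q⁻ S ⁅ v ⁆ u∈S∪v | x∈p∪q⁻ S ⁅ v ⁆ w∈S∪v
          ... | inj₁ u∈S | inj₁ w∈S = independent u w u∈S w∈S u~w
          ... | inj₁ u∈S | inj₂ w∈v with refl ← x∈⁅y⁆⇒x≡y v w∈v =
                undominated (toℕ u , ∈⇒bit u∈S , subst (Adj (toℕ u)) toℕv≡y u~w)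
          ... | inj₂ u∈v | inj₁ w∈S with refl ← x∈⁅y⁆⇒x≡y v u∈v =
                undominated (toℕ w , ∈⇒bit w∈S , subst (Adj (toℕ w)) toℕv≡y (Adj-sym u~w))
          ... | inj₂ u∈v | inj₂ w∈v with refl ← x∈⁅y⁆⇒x≡y v u∈v | refl ← x∈⁅y⁆⇒x≡y v w∈v =
                Adj-irrefl u~w

  does-maximalIndependent? : ∀ n S →
    does (maximalIndependent? (suc n) S) ≡ onePerTriangleᵇ (suc n) (toList S)
  does-maximalIndependent? n S with onePerTriangleᵇ (suc n) (toList S) in e
  ... | true  = dec-true (maximalIndependent? (suc n) S)
    (onePerTriangle⇒maximalIndependent n S (onePerTriangleᵇ-sound (suc n) (toList S) e))
  ... | false = dec-false (maximalIndependent? (suc n) S) λ mi → true≢false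
    (onePerTriangleᵇ-complete (suc n) (toList S) (maximalIndependent⇒onePerTriangle n S mi)) e

  -- selections n b k counts the choices of one vertex per triangle of T(n), k vertices in all,
  -- with vertex 0 chosen iff b.
  selections : ℕ → Bool → ℕ → ℕ
  selections n b k =
    countLists (double n) (λ l → onePerTriangleᵇ n (b ∷ l) ∧ (ones (b ∷ l) ≡ᵇ k))

  t≡selections : ∀ n k → t (suc n) k ≡ selections (suc n) true k + selections (suc n) false k
  t≡selections n k = trans
    (length-filter-allSubsets (numVertices (suc n)) _ P λ S →
      cong₂ _∧_ (does-maximalIndependent? n S) (cong (_≡ᵇ k) (∣∣≡ones S)))
    (cong (λ m → countLists m P) (numVertices-suc n))
    where
      P : List Bool → Bool
      P l = onePerTriangleᵇ (suc n) l ∧ (ones l ≡ᵇ k)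

  selections-true-zero : ∀ n → selections n true 0 ≡ 0
  selections-true-zero n =
    trans (countLists-cong (double n) λ l → ∧-zeroʳ _) (countLists-false (double n))

  selections-true-suc : ∀ n k → selections (suc n) true (suc k) ≡ selections n false k
  selections-true-suc n k rewrite countLists-false (double n) = refl

  selections-false : ∀ n k →
    selections (suc n) false k ≡ selections (suc n) true k + selections n true k
  selections-false n k rewrite countLists-false (double n) =
    cong (countLists (double n) (λ l → onePerTriangleᵇ n (false ∷ l) ∧ (suc (ones l) ≡ᵇ k)) +_)
         (+-identityʳ (selections n true k))

  t-suc-zero : ∀ n → t (suc n) 0 ≡ 0
  t-suc-zero n = trans (t≡selections n 0) (cong₂ _+_ (selections-true-zero (suc n))
    (trans (selections-false n 0) (cong₂ _+_ (selections-true-zero (suc n)) (selections-true-zero n))))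

  t-recurrence : ∀ n k → t (3 + n) (suc k) ≡ t (2 + n) k + t (1 + n) k
  t-recurrence n k = begin
    t (3 + n) (suc k)
      ≡⟨ t≡selections (2 + n) (suc k) ⟩
    selections (3 + n) true (suc k) + selections (3 + n) false (suc k)
      ≡⟨ cong₂ _+_ (selections-true-suc (2 + n) k) (trans (selections-false (2 + n) (suc k))
           (cong₂ _+_ (selections-true-suc (2 + n) k) (selections-true-suc (1 + n) k))) ⟩
    F₂ + (F₂ + F₁)
      ≡⟨ cong (λ f → f + (f + F₁)) (selections-false (1 + n) k) ⟩
    (T₂ + T₁) + ((T₂ + T₁) + F₁)
      ≡⟨ solve 3 (λ a b c → (a :+ b) :+ ((a :+ b) :+ c) := (a :+ (a :+ b)) :+ (b :+ c))
           refl T₂ T₁ F₁ ⟩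
    (T₂ + (T₂ + T₁)) + (T₁ + F₁)
      ≡⟨ sym (cong₂ _+_ (trans (t≡selections (1 + n) k) (cong (T₂ +_) (selections-false (1 + n) k)))
                        (t≡selections n k)) ⟩
    t (2 + n) k + t (1 + n) k ∎
    where
      open ≡-Reasoning
      open +-*-Solver

      T₂ T₁ F₂ F₁ : ℕ
      T₂ = selections (2 + n) true k
      T₁ = selections (1 + n) true k
      F₂ = selections (2 + n) false k
      F₁ = selections (1 + n) false k

open PowerSeries
open TriangularCactus
open import Data.Nat using (suc)
open import Data.Integer using (ℤ; +_; 0ℤ; _+_; _-_)
open import Data.Integer.Properties using (pos-+; +-inverseʳ)

tGF-functional-equation : ∀ n k → tGF n k - (shift 1 1 tGF n k + shift 2 1 tGF n k) ≡ numer n k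
tGF-functional-equation 0 0                     = refl
tGF-functional-equation 0 (suc k)               = refl
tGF-functional-equation 1 0                     = refl
tGF-functional-equation 1 1                     = refl
tGF-functional-equation 1 (suc (suc k))         = refl
tGF-functional-equation 2 0                     = refl
tGF-functional-equation 2 1                     = refl
tGF-functional-equation 2 2                     = refl
tGF-functional-equation 2 (suc (suc (suc k)))   = refl
tGF-functional-equation (suc (suc (suc n))) 0   =
  cong (λ m → + m - (0ℤ + 0ℤ)) (t-suc-zero (suc (suc n)))
tGF-functional-equation (suc (suc (suc n))) (suc k) = begin
  + t (suc (suc (suc n))) (suc k) - s
    ≡⟨ cong (_- s) (trans (cong +_ (t-recurrence n k)) (pos-+ (t (suc (suc n)) k) (t (suc n) k))) ⟩
  s - s
    ≡⟨ +-inverseʳ s ⟩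
  0ℤ ∎
  where
    open ≡-Reasoning

    s : ℤ
    s = + t (suc (suc n)) k + + t (suc n) k

theorem2p1 : ∀ n k → (tGF ⋆ denom) n k ≡ numer n k
theorem2p1 n k = trans (⋆-denom tGF n k) (tGF-functional-equation n k)
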